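{- Let $G$ be a finite bipartite graph. Let $y$ and $z$ be two neighbours of a vertex $x$ such that $N^2(x)\subseteq N(y)\cup N(z)$. Then one of $y$ and $z$ is rare, i.e. belongs to at most half of the maximal stable sets of $G$.
   Context: $N(v)$ is the set of neighbours of a vertex $v$, $N(S)$ the set of vertices adjacent to some vertex of $S$, and $N^2(x)=N(N(x))$. A set of vertices is stable if no two are adjacent; maximal means maximal under inclusion. A vertex $v$ is rare if $|\mathcal A_v|\le\frac12|\mathcal A|$, where $\mathcal A$ is the set of all maximal stable sets of $G$ and $\mathcal A_v$ those containing $v$. -}

module Defs where

open import Data.Bool using (Bool; true; false; T; if_then_else_)
open import Data.Nat using (ℕ; zero; suc; _+_)
open import Data.Fin using (Fin)
open import Data.Vec using ([]; _∷_)
open import Data.Fin.Subset using (Subset; _∈_; _⊂_; inside; outside)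
open import Data.Fin.Subset.Properties using (_∈?_; _⊂?_; anySubset?)
open import Data.Fin.Properties using (all?)
open import Data.Product using (Σ; ∃; _×_; _,_)
open import Data.Sum using (_⊎_)
open import Relation.Nullary using (¬_; Dec; yes; no)
open import Relation.Nullary.Decidable using (⌊_⌋; _×-dec_; _→-dec_; ¬?)
open import Relation.Binary.PropositionalEquality using (_≡_)

record Graph (n : ℕ) : Set where
  field
    adj       : Fin n → Fin n → Bool
    adj-sym   : ∀ u v → T (adj u v) → T (adj v u)
    adj-irrefl : ∀ v → ¬ T (adj v v)

module _ {n : ℕ} (G : Graph n) where
  open Graph G

  Adj : Fin n → Fin n → Set
  Adj u v = T (adj u v)

  Bipartite : Set
  Bipartite = Σ (Fin n → Bool) λ c → ∀ u v → Adj u v → ¬ (c u ≡ c v)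

  InN : Fin n → Fin n → Set
  InN v w = Adj v w

  InN² : Fin n → Fin n → Set
  InN² x w = ∃ λ u → Adj x u × Adj u w

  Stable : Subset n → Set
  Stable S = ∀ u v → u ∈ S → v ∈ S → ¬ Adj u v

  MaximalStable : Subset n → Set
  MaximalStable S = Stable S × ¬ (∃ λ T → Stable T × S ⊂ T)

  Adj? : ∀ u v → Dec (Adj u v)
  Adj? u v with adj u v
  ... | true  = yes _
  ... | false = no λ ()

  Stable? : ∀ S → Dec (Stable S)
  Stable? S = all? λ u → all? λ v → (u ∈? S) →-dec ((v ∈? S) →-dec ¬? (Adj? u v))

  MaximalStable? : ∀ S → Dec (MaximalStable S)
  MaximalStable? S = Stable? S ×-dec ¬? (anySubset? λ T → Stable? T ×-dec (S ⊂? T))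

countSubsets : ∀ {n} {P : Subset n → Set} → (∀ S → Dec (P S)) → ℕ
countSubsets {zero}  P? = if ⌊ P? [] ⌋ then 1 else 0
countSubsets {suc n} P? =
  countSubsets (λ S → P? (inside ∷ S)) + countSubsets (λ S → P? (outside ∷ S))

module _ {n : ℕ} (G : Graph n) where

  #MaxStable : ℕ
  #MaxStable = countSubsets (MaximalStable? G)

  #MaxStableContaining : Fin n → ℕ
  #MaxStableContaining v = countSubsets (λ S → MaximalStable? G S ×-dec (v ∈? S))

  Rare : Fin n → Set
  Rare v = 2 Data.Nat.* #MaxStableContaining v Data.Nat.≤ #MaxStable

-- If S is a maximal stable set containing y and z, then S misses N²(x) ⊆ N(y) ∪ N(z), so by
-- maximality N(x) ⊆ S. Trading N(x) for x and extending gives a maximal stable set T avoiding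
-- y and z, and S = N(x) ∪ (T ∖ (N(x) ∪ N²(x))) is recovered from T. Hence at most as many maximal
-- stable sets contain both y and z as contain neither, and inclusion–exclusion then gives
-- |𝒜_y| + |𝒜_z| ≤ |𝒜|.

module Submission where

open import Data.Bool using (if_then_else_; _≟_)
open import Data.Bool.Properties using (T-≡)
open import Data.Empty using (⊥-elim)
open import Data.Fin using (Fin)
open import Data.Fin.Properties using (any?)
open import Data.Fin.Subset using (Subset; _∈_; _∉_; _⊆_; _⊃_; inside; outside; ⁅_⁆; _∪_; _∩_; ∁)
open import Data.Fin.Subset.Properties using (_∈?_; _⊂?_; anySubset?; x∈⁅x⁆; x∈⁅y⁆⇒x≡y; p⊆p∪q; x∈p∪q⁺; x∈p∪q⁻; x∈p∩q⁺; x∈p∩q⁻; x∈∁p⇒x∉p; x∉p⇒x∈∁p; ⊆-trans; ⊆-antisym)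
open import Data.Fin.Subset.Induction using (Acc; acc; ⊃-wellFounded)
open import Data.Nat using (ℕ; zero; suc; _+_; _*_; _≤_; z≤n)
open import Data.Nat.Properties using (≤-refl; ≤-trans; +-cancelʳ-≤; ≤-reflexive; ≤-total; +-mono-≤; +-monoˡ-≤; +-monoʳ-≤; +-identityʳ; m≤m+n; m≤n+m; +-commutativeSemigroup; module ≤-Reasoning)
open import Algebra.Properties.CommutativeSemigroup +-commutativeSemigroup using (interchange)
open import Data.Product using (∃; _×_; _,_; proj₁; proj₂)
open import Data.Sum using (_⊎_; inj₁; inj₂)
open import Data.Vec using ([]; _∷_; tabulate)
open import Data.Vec.Properties using (∷-injectiveʳ; ≡-dec; lookup∘tabulate; lookup⇒[]=; []=⇒lookup)
open import Function using (_∘_)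
open import Function.Bundles using (Equivalence)
open import Relation.Binary.PropositionalEquality using (_≡_; _≢_; refl; sym; trans; cong; cong₂; module ≡-Reasoning)
open import Relation.Nullary using (¬_; Dec; yes; no; contradiction)
open import Relation.Nullary.Decidable using (⌊_⌋; _×-dec_; ¬?; toWitness; isYes≗does; dec-true)

open import Defs

private
  variable
    n : ℕ
    A B C : Set
    P Q : Subset n → Set

-- ⌊_⌋ rather than does, so that it agrees with countSubsets definitionally.
𝟙 : Dec A → ℕ
𝟙 a? = if ⌊ a? ⌋ then 1 else 0

𝟙-yes : (a? : Dec A) → A → 𝟙 a? ≡ 1
𝟙-yes (yes _) _ = refl
𝟙-yes (no ¬a) a = contradiction a ¬a

𝟙-no : (a? : Dec A) → ¬ A → 𝟙 a? ≡ 0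
𝟙-no (yes a) ¬a = contradiction a ¬a
𝟙-no (no _)  _  = refl

𝟙-×-≤ : (a? : Dec A) (b? : Dec B) → 𝟙 (a? ×-dec b?) ≤ 𝟙 a?
𝟙-×-≤ (yes _) (yes _) = ≤-refl
𝟙-×-≤ (yes _) (no _)  = z≤n
𝟙-×-≤ (no _)  _       = ≤-refl

𝟙-inclusion-exclusion : (a? : Dec A) (b? : Dec B) (c? : Dec C) →
  𝟙 (a? ×-dec b?) + 𝟙 (a? ×-dec c?) + 𝟙 ((a? ×-dec ¬? b?) ×-dec ¬? c?) ≡
  𝟙 a? + 𝟙 ((a? ×-dec b?) ×-dec c?)
𝟙-inclusion-exclusion (yes _) (yes _) (yes _) = refl
𝟙-inclusion-exclusion (yes _) (yes _) (no _)  = refl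
𝟙-inclusion-exclusion (yes _) (no _)  (yes _) = refl
𝟙-inclusion-exclusion (yes _) (no _)  (no _)  = refl
𝟙-inclusion-exclusion (no _)  _       _       = refl

sumSubsets : (Subset n → ℕ) → ℕ
sumSubsets {zero}  f = f []
sumSubsets {suc n} f = sumSubsets (λ S → f (inside ∷ S)) + sumSubsets (λ S → f (outside ∷ S))

countSubsets≡sumSubsets-𝟙 : (P? : ∀ S → Dec (P S)) → countSubsets P? ≡ sumSubsets (𝟙 ∘ P?)
countSubsets≡sumSubsets-𝟙 {zero}  P? = refl
countSubsets≡sumSubsets-𝟙 {suc n} P? =
  cong₂ _+_ (countSubsets≡sumSubsets-𝟙 (λ S → P? (inside ∷ S)))
            (countSubsets≡sumSubsets-𝟙 (λ S → P? (outside ∷ S)))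

sumSubsets-cong : {f g : Subset n → ℕ} → (∀ S → f S ≡ g S) → sumSubsets f ≡ sumSubsets g
sumSubsets-cong {zero}  f≡g = f≡g []
sumSubsets-cong {suc n} f≡g =
  cong₂ _+_ (sumSubsets-cong (λ S → f≡g (inside ∷ S))) (sumSubsets-cong (λ S → f≡g (outside ∷ S)))

sumSubsets-mono : {f g : Subset n → ℕ} → (∀ S → f S ≤ g S) → sumSubsets f ≤ sumSubsets g
sumSubsets-mono {zero}  f≤g = f≤g []
sumSubsets-mono {suc n} f≤g =
  +-mono-≤ (sumSubsets-mono (λ S → f≤g (inside ∷ S))) (sumSubsets-mono (λ S → f≤g (outside ∷ S)))

sumSubsets-+ : (f g : Subset n → ℕ) → sumSubsets (λ S → f S + g S) ≡ sumSubsets f + sumSubsets g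
sumSubsets-+ {zero}  f g = refl
sumSubsets-+ {suc n} f g =
  trans (cong₂ _+_ (sumSubsets-+ (λ S → f (inside ∷ S)) (λ S → g (inside ∷ S)))
                   (sumSubsets-+ (λ S → f (outside ∷ S)) (λ S → g (outside ∷ S))))
        (interchange (sumSubsets (λ S → f (inside ∷ S))) _ _ _)

sumSubsets-comm : {m : ℕ} (f : Subset m → Subset n → ℕ) →
  sumSubsets (λ S → sumSubsets (f S)) ≡ sumSubsets (λ T → sumSubsets (λ S → f S T))
sumSubsets-comm {m = zero}  f = refl
sumSubsets-comm {m = suc m} f =
  trans (cong₂ _+_ (sumSubsets-comm (λ S → f (inside ∷ S))) (sumSubsets-comm (λ S → f (outside ∷ S))))
        (sym (sumSubsets-+ (λ T → sumSubsets (λ S → f (inside ∷ S) T))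
                           (λ T → sumSubsets (λ S → f (outside ∷ S) T))))

sumSubsets-zero : {f : Subset n → ℕ} → (∀ S → f S ≡ 0) → sumSubsets f ≡ 0
sumSubsets-zero {zero}  f≡0 = f≡0 []
sumSubsets-zero {suc n} f≡0 =
  cong₂ _+_ (sumSubsets-zero (λ S → f≡0 (inside ∷ S))) (sumSubsets-zero (λ S → f≡0 (outside ∷ S)))

sumSubsets-point : {f : Subset n → ℕ} (U : Subset n) → (∀ S → S ≢ U → f S ≡ 0) → sumSubsets f ≡ f U
sumSubsets-point [] _ = refl
sumSubsets-point (inside ∷ U) f≡0 =
  trans (cong₂ _+_ (sumSubsets-point U (λ S S≢U → f≡0 (inside ∷ S) (S≢U ∘ ∷-injectiveʳ)))
                   (sumSubsets-zero (λ S → f≡0 (outside ∷ S) λ ())))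
        (+-identityʳ _)
sumSubsets-point (outside ∷ U) f≡0 =
  cong₂ _+_ (sumSubsets-zero (λ S → f≡0 (inside ∷ S) λ ()))
            (sumSubsets-point U (λ S S≢U → f≡0 (outside ∷ S) (S≢U ∘ ∷-injectiveʳ)))

term≤sumSubsets : (f : Subset n → ℕ) (U : Subset n) → f U ≤ sumSubsets f
term≤sumSubsets f [] = ≤-refl
term≤sumSubsets f (inside ∷ U) = ≤-trans (term≤sumSubsets (λ S → f (inside ∷ S)) U) (m≤m+n _ _)
term≤sumSubsets f (outside ∷ U) = ≤-trans (term≤sumSubsets (λ S → f (outside ∷ S)) U) (m≤n+m _ _)

countSubsets-inclusion-exclusion : {A Y Z : Subset n → Set}
  (A? : ∀ S → Dec (A S)) (Y? : ∀ S → Dec (Y S)) (Z? : ∀ S → Dec (Z S)) →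
  countSubsets (λ S → A? S ×-dec Y? S) + countSubsets (λ S → A? S ×-dec Z? S)
    + countSubsets (λ S → (A? S ×-dec ¬? (Y? S)) ×-dec ¬? (Z? S)) ≡
  countSubsets A? + countSubsets (λ S → (A? S ×-dec Y? S) ×-dec Z? S)
countSubsets-inclusion-exclusion {A = A} {Y} {Z} A? Y? Z? = begin
  countSubsets AY? + countSubsets AZ? + countSubsets neither?
    ≡⟨ cong₂ _+_ (cong₂ _+_ (countSubsets≡sumSubsets-𝟙 AY?) (countSubsets≡sumSubsets-𝟙 AZ?))
                 (countSubsets≡sumSubsets-𝟙 neither?) ⟩
  sumSubsets (𝟙 ∘ AY?) + sumSubsets (𝟙 ∘ AZ?) + sumSubsets (𝟙 ∘ neither?)
    ≡⟨ cong (_+ sumSubsets (𝟙 ∘ neither?)) (sumSubsets-+ (𝟙 ∘ AY?) (𝟙 ∘ AZ?)) ⟨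
  sumSubsets (λ S → 𝟙 (AY? S) + 𝟙 (AZ? S)) + sumSubsets (𝟙 ∘ neither?)
    ≡⟨ sumSubsets-+ (λ S → 𝟙 (AY? S) + 𝟙 (AZ? S)) (𝟙 ∘ neither?) ⟨
  sumSubsets (λ S → 𝟙 (AY? S) + 𝟙 (AZ? S) + 𝟙 (neither? S))
    ≡⟨ sumSubsets-cong (λ S → 𝟙-inclusion-exclusion (A? S) (Y? S) (Z? S)) ⟩
  sumSubsets (λ S → 𝟙 (A? S) + 𝟙 (both? S))
    ≡⟨ sumSubsets-+ (𝟙 ∘ A?) (𝟙 ∘ both?) ⟩
  sumSubsets (𝟙 ∘ A?) + sumSubsets (𝟙 ∘ both?)
    ≡⟨ cong₂ _+_ (countSubsets≡sumSubsets-𝟙 A?) (countSubsets≡sumSubsets-𝟙 both?) ⟨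
  countSubsets A? + countSubsets both? ∎
  where
    open ≡-Reasoning
    AY? : ∀ S → Dec (A S × Y S)
    AY? S = A? S ×-dec Y? S
    AZ? : ∀ S → Dec (A S × Z S)
    AZ? S = A? S ×-dec Z? S
    neither? : ∀ S → Dec ((A S × ¬ Y S) × ¬ Z S)
    neither? S = (A? S ×-dec ¬? (Y? S)) ×-dec ¬? (Z? S)
    both? : ∀ S → Dec ((A S × Y S) × Z S)
    both? S = (A? S ×-dec Y? S) ×-dec Z? S

countSubsets-≤-onto : (P? : ∀ S → Dec (P S)) (Q? : ∀ S → Dec (Q S)) (g : Subset n → Subset n) →
  (∀ S → P S → ∃ λ T → Q T × g T ≡ S) → countSubsets P? ≤ countSubsets Q?
countSubsets-≤-onto P? Q? g onto = begin
  countSubsets P?                                   ≡⟨ countSubsets≡sumSubsets-𝟙 P? ⟩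
  sumSubsets (𝟙 ∘ P?)                               ≤⟨ sumSubsets-mono hit ⟩
  sumSubsets (λ S → sumSubsets (λ T → hits T S))    ≡⟨ sumSubsets-comm (λ S T → hits T S) ⟩
  sumSubsets (λ T → sumSubsets (hits T))            ≡⟨ sumSubsets-cong (λ T → sumSubsets-point (g T) (miss T)) ⟩
  sumSubsets (λ T → hits T (g T))                   ≤⟨ sumSubsets-mono (λ T → 𝟙-×-≤ (Q? T) _) ⟩
  sumSubsets (𝟙 ∘ Q?)                               ≡⟨ countSubsets≡sumSubsets-𝟙 Q? ⟨
  countSubsets Q?                                   ∎
  where
    open ≤-Reasoning
    hits : Subset _ → Subset _ → ℕ
    hits T S = 𝟙 (Q? T ×-dec ≡-dec _≟_ (g T) S)
    hit : ∀ S → 𝟙 (P? S) ≤ sumSubsets (λ T → hits T S)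
    hit S with P? S
    ... | no _  = z≤n
    ... | yes p with T , q , gT≡S ← onto S p =
      ≤-trans (≤-reflexive (sym (𝟙-yes _ (q , gT≡S)))) (term≤sumSubsets (λ T → hits T S) T)
    miss : ∀ T S → S ≢ g T → hits T S ≡ 0
    miss T S S≢gT = 𝟙-no _ (λ (_ , gT≡S) → S≢gT (sym gT≡S))

m+n≤o⇒2m≤o⊎2n≤o : ∀ m n {o} → m + n ≤ o → 2 * m ≤ o ⊎ 2 * n ≤ o
m+n≤o⇒2m≤o⊎2n≤o m n {o} m+n≤o with ≤-total m n
... | inj₁ m≤n = inj₁ (begin
  2 * m      ≡⟨ cong (m +_) (+-identityʳ m) ⟩
  m + m      ≤⟨ +-monoʳ-≤ m m≤n ⟩
  m + n      ≤⟨ m+n≤o ⟩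
  o          ∎)
  where open ≤-Reasoning
... | inj₂ n≤m = inj₂ (begin
  2 * n      ≡⟨ cong (n +_) (+-identityʳ n) ⟩
  n + n      ≤⟨ +-monoˡ-≤ n n≤m ⟩
  m + n      ≤⟨ m+n≤o ⟩
  o          ∎)
  where open ≤-Reasoning

subsetOf : {P : Fin n → Set} → (∀ i → Dec (P i)) → Subset n
subsetOf P? = tabulate (λ i → ⌊ P? i ⌋)

module _ {P : Fin n → Set} (P? : ∀ i → Dec (P i)) {i : Fin n} where

  ∈-subsetOf⁺ : P i → i ∈ subsetOf P?
  ∈-subsetOf⁺ p =
    lookup⇒[]= i _ (trans (lookup∘tabulate _ i) (trans (isYes≗does (P? i)) (dec-true (P? i) p)))

  ∈-subsetOf⁻ : i ∈ subsetOf P? → P i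
  ∈-subsetOf⁻ i∈ = toWitness (Equivalence.from T-≡ (trans (sym (lookup∘tabulate _ i)) ([]=⇒lookup i∈)))

module _ (G : Graph n) where
  open Graph G using (adj-sym; adj-irrefl)

  stable-∪-⁅⁆ : ∀ {S i} → Stable G S → (∀ u → u ∈ S → ¬ Adj G u i) → Stable G (S ∪ ⁅ i ⁆)
  stable-∪-⁅⁆ {S} {i} stS noNb u v u∈ v∈ u∼v with x∈p∪q⁻ S ⁅ i ⁆ u∈ | x∈p∪q⁻ S ⁅ i ⁆ v∈
  ... | inj₁ u∈S | inj₁ v∈S = stS u v u∈S v∈S u∼v
  ... | inj₁ u∈S | inj₂ v∈i rewrite x∈⁅y⁆⇒x≡y i v∈i = noNb u u∈S u∼v
  ... | inj₂ u∈i | inj₁ v∈S rewrite x∈⁅y⁆⇒x≡y i u∈i = noNb v v∈S (adj-sym i v u∼v)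
  ... | inj₂ u∈i | inj₂ v∈i rewrite x∈⁅y⁆⇒x≡y i u∈i | x∈⁅y⁆⇒x≡y i v∈i = adj-irrefl i u∼v

  ∈-maximalStable : ∀ {S i} → MaximalStable G S → (∀ u → u ∈ S → ¬ Adj G u i) → i ∈ S
  ∈-maximalStable {S} {i} (stS , maxS) noNb with i ∈? S
  ... | yes i∈S = i∈S
  ... | no  i∉S =
    ⊥-elim (maxS (S ∪ ⁅ i ⁆ , stable-∪-⁅⁆ stS noNb , p⊆p∪q ⁅ i ⁆ , i , x∈p∪q⁺ (inj₂ (x∈⁅x⁆ i)) , i∉S))

  ⊆-maximalStable : ∀ {S} → Stable G S → ∃ λ T → MaximalStable G T × S ⊆ T
  ⊆-maximalStable {S} = extend S (⊃-wellFounded S)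
    where
      extend : ∀ S → Acc _⊃_ S → Stable G S → ∃ λ T → MaximalStable G T × S ⊆ T
      extend S (acc larger) stS with anySubset? (λ T → Stable? G T ×-dec (S ⊂? T))
      ... | no  maxS = S , (stS , maxS) , λ i∈S → i∈S
      ... | yes (T , stT , S⊂T) with U , maxU , T⊆U ← extend T (larger S⊂T) stT =
        U , maxU , ⊆-trans (proj₁ S⊂T) T⊆U

module Exchange (G : Graph n) (x y z : Fin n) (x∼y : Adj G x y) (x∼z : Adj G x z)
                (N²x⊆Ny∪Nz : ∀ w → InN² G x w → InN G y w ⊎ InN G z w) where
  open Graph G using (adj-sym; adj-irrefl)

  InN²? : ∀ w → Dec (InN² G x w)
  InN²? w = any? λ u → Adj? G x u ×-dec Adj? G u w

  Nx N²x : Subset n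
  Nx  = subsetOf (Adj? G x)
  N²x = subsetOf InN²?

  restore : Subset n → Subset n
  restore T = Nx ∪ (T ∩ ∁ (Nx ∪ N²x))

  module _ {S} (maxS : MaximalStable G S) (y∈S : y ∈ S) (z∈S : z ∈ S) where

    N²x∩S≡∅ : ∀ {w} → InN² G x w → w ∉ S
    N²x∩S≡∅ {w} x∼∼w w∈S with N²x⊆Ny∪Nz w x∼∼w
    ... | inj₁ y∼w = proj₁ maxS y w y∈S w∈S y∼w
    ... | inj₂ z∼w = proj₁ maxS z w z∈S w∈S z∼w

    Nx⊆S : ∀ {u} → Adj G x u → u ∈ S
    Nx⊆S {u} x∼u = ∈-maximalStable G maxS λ w w∈S w∼u → N²x∩S≡∅ (u , x∼u , adj-sym w u w∼u) w∈S

    ∉Nx∪N²x : ∀ {i} → ¬ Adj G x i → i ∈ S → i ∉ Nx ∪ N²x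
    ∉Nx∪N²x {i} ¬x∼i i∈S i∈ with x∈p∪q⁻ Nx N²x i∈
    ... | inj₁ i∈Nx  = ¬x∼i (∈-subsetOf⁻ (Adj? G x) i∈Nx)
    ... | inj₂ i∈N²x = N²x∩S≡∅ (∈-subsetOf⁻ InN²? i∈N²x) i∈S

    S₀ : Subset n
    S₀ = ⁅ x ⁆ ∪ (S ∩ ∁ Nx)

    S₀-stable : Stable G S₀
    S₀-stable u v u∈ v∈ u∼v with x∈p∪q⁻ ⁅ x ⁆ _ u∈ | x∈p∪q⁻ ⁅ x ⁆ _ v∈
    ... | inj₁ u∈x | inj₁ v∈x rewrite x∈⁅y⁆⇒x≡y x u∈x | x∈⁅y⁆⇒x≡y x v∈x = adj-irrefl x u∼v
    ... | inj₁ u∈x | inj₂ v∈S∖Nx rewrite x∈⁅y⁆⇒x≡y x u∈x =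
      x∈∁p⇒x∉p (proj₂ (x∈p∩q⁻ S _ v∈S∖Nx)) (∈-subsetOf⁺ (Adj? G x) u∼v)
    ... | inj₂ u∈S∖Nx | inj₁ v∈x rewrite x∈⁅y⁆⇒x≡y x v∈x =
      x∈∁p⇒x∉p (proj₂ (x∈p∩q⁻ S _ u∈S∖Nx)) (∈-subsetOf⁺ (Adj? G x) (adj-sym u x u∼v))
    ... | inj₂ u∈S∖Nx | inj₂ v∈S∖Nx =
      proj₁ maxS u v (proj₁ (x∈p∩q⁻ S _ u∈S∖Nx)) (proj₁ (x∈p∩q⁻ S _ v∈S∖Nx)) u∼v

    module _ {T} (maxT : MaximalStable G T) (S₀⊆T : S₀ ⊆ T) where

      S∖Nx⊆T : ∀ {i} → ¬ Adj G x i → i ∈ S → i ∈ T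
      S∖Nx⊆T ¬x∼i i∈S =
        S₀⊆T (x∈p∪q⁺ (inj₂ (x∈p∩q⁺ (i∈S , x∉p⇒x∈∁p (¬x∼i ∘ ∈-subsetOf⁻ (Adj? G x))))))

      Nx∩T≡∅ : ∀ {u} → Adj G x u → u ∉ T
      Nx∩T≡∅ {u} x∼u u∈T = proj₁ maxT x u (S₀⊆T (x∈p∪q⁺ (inj₁ (x∈⁅x⁆ x)))) u∈T x∼u

      restore⊆S : restore T ⊆ S
      restore⊆S {i} i∈ with x∈p∪q⁻ Nx _ i∈
      ... | inj₁ i∈Nx = Nx⊆S (∈-subsetOf⁻ (Adj? G x) i∈Nx)
      ... | inj₂ i∈T∖Nx∪N²x = ∈-maximalStable G maxS noNeighbour
        where
          i∈T : i ∈ T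
          i∈T = proj₁ (x∈p∩q⁻ T _ i∈T∖Nx∪N²x)
          i∉Nx∪N²x : i ∉ Nx ∪ N²x
          i∉Nx∪N²x = x∈∁p⇒x∉p (proj₂ (x∈p∩q⁻ T _ i∈T∖Nx∪N²x))
          noNeighbour : ∀ u → u ∈ S → ¬ Adj G u i
          noNeighbour u u∈S u∼i with Adj? G x u
          ... | yes x∼u = i∉Nx∪N²x (x∈p∪q⁺ (inj₂ (∈-subsetOf⁺ InN²? (u , x∼u , u∼i))))
          ... | no ¬x∼u = proj₁ maxT u _ (S∖Nx⊆T ¬x∼u u∈S) i∈T u∼i

      S⊆restore : S ⊆ restore T
      S⊆restore {i} i∈S with Adj? G x i
      ... | yes x∼i = x∈p∪q⁺ (inj₁ (∈-subsetOf⁺ (Adj? G x) x∼i))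
      ... | no ¬x∼i = x∈p∪q⁺ (inj₂ (x∈p∩q⁺ (S∖Nx⊆T ¬x∼i i∈S , x∉p⇒x∈∁p (∉Nx∪N²x ¬x∼i i∈S))))

    exchange : ∃ λ T → ((MaximalStable G T × y ∉ T) × z ∉ T) × restore T ≡ S
    exchange =
      let T , maxT , S₀⊆T = ⊆-maximalStable G S₀-stable
      in T , ((maxT , Nx∩T≡∅ maxT S₀⊆T x∼y) , Nx∩T≡∅ maxT S₀⊆T x∼z) ,
         ⊆-antisym (restore⊆S maxT S₀⊆T) (S⊆restore maxT S₀⊆T)

lemma10 : ∀ {n : ℕ} (G : Graph n) → Bipartite G →
    (x y z : Fin n) → Adj G x y → Adj G x z →
    (∀ w → InN² G x w → InN G y w ⊎ InN G z w) →
    Rare G y ⊎ Rare G z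
lemma10 G _ x y z x∼y x∼z N²x⊆Ny∪Nz =
  m+n≤o⇒2m≤o⊎2n≤o (#MaxStableContaining G y) (#MaxStableContaining G z)
    (+-cancelʳ-≤ #neither _ _ (begin
      #MaxStableContaining G y + #MaxStableContaining G z + #neither
        ≡⟨ countSubsets-inclusion-exclusion (MaximalStable? G) (y ∈?_) (z ∈?_) ⟩
      #MaxStable G + #both
        ≤⟨ +-monoʳ-≤ (#MaxStable G) #both≤#neither ⟩
      #MaxStable G + #neither ∎))
  where
    open ≤-Reasoning
    open Exchange G x y z x∼y x∼z N²x⊆Ny∪Nz
    #both #neither : ℕ
    #both    = countSubsets λ S → (MaximalStable? G S ×-dec (y ∈? S)) ×-dec (z ∈? S)
    #neither = countSubsets λ S → (MaximalStable? G S ×-dec ¬? (y ∈? S)) ×-dec ¬? (z ∈? S)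
    #both≤#neither : #both ≤ #neither
    #both≤#neither = countSubsets-≤-onto _ _ restore λ _ ((maxS , y∈S) , z∈S) → exchange maxS y∈S z∈S
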